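{- For every $n\ge3$, $\mathrm{nbet}(n)\ge\log_2\log_2 n+1$.
   Context: An ordering of $[n]$ is a bijection $\phi:[n]\to[n]$, where $\phi(x)$ is the position of $x$. A ternary constraint is a triple $(x_1,x_2,x_3)$ of distinct elements of $[n]$. $\phi$ nonbetween-satisfies the constraint unless $\phi(x_1)<\phi(x_2)<\phi(x_3)$ or $\phi(x_3)<\phi(x_2)<\phi(x_1)$. $\mathrm{nbet}(n)$ is the minimum size of a set of orderings of $[n]$ such that every ternary constraint is nonbetween-satisfied by at least one ordering in the set. -}

module Defs where

open import Data.Nat using (ℕ)
open import Data.Fin using (Fin; _<_)
open import Data.Fin.Permutation using (Permutation′; _⟨$⟩ʳ_)
open import Data.Product using (_×_; ∃)
open import Data.Sum using (_⊎_)
open import Relation.Nullary using (¬_)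
open import Relation.Binary.PropositionalEquality using (_≢_)

-- An ordering of [n] (identified with Fin n) is a bijection φ : [n] → [n];
-- φ x (= φ ⟨$⟩ʳ x) is the position of x.
Ordering : ℕ → Set
Ordering n = Permutation′ n

Between : ∀ {n} → Ordering n → Fin n → Fin n → Fin n → Set
Between φ x₁ x₂ x₃ =
  ((φ ⟨$⟩ʳ x₁) < (φ ⟨$⟩ʳ x₂) × (φ ⟨$⟩ʳ x₂) < (φ ⟨$⟩ʳ x₃))
  ⊎ ((φ ⟨$⟩ʳ x₃) < (φ ⟨$⟩ʳ x₂) × (φ ⟨$⟩ʳ x₂) < (φ ⟨$⟩ʳ x₁))

NonbetSat : ∀ {n} → Ordering n → Fin n → Fin n → Fin n → Set
NonbetSat φ x₁ x₂ x₃ = ¬ Between φ x₁ x₂ x₃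

NbetFamily : (n k : ℕ) → (Fin k → Ordering n) → Set
NbetFamily n k fam =
  ∀ (x₁ x₂ x₃ : Fin n) → x₁ ≢ x₂ → x₂ ≢ x₃ → x₁ ≢ x₃ →
  ∃ λ (i : Fin k) → NonbetSat (fam i) x₁ x₂ x₃

module Submission where

-- Say that a family of orderings covers a list xs if every triple x, y, z
-- occurring in this order in xs is nonbetween-satisfied by a member of the
-- family.  The empty family covers only lists of length ≤ 2.  If xs is
-- monotone (increasing or decreasing) in the first ordering φ₀, then φ₀
-- puts the middle element of every triple of xs between the others, so the
-- remaining orderings already cover xs.  Hence, by induction on k, a
-- duplicate-free list covered by k orderings has length ≤ 2 ^ (2 ^ k):
-- its sublists monotone in φ₀ are covered by the other k - 1 orderings,
-- and the Erdős–Szekeres theorem squares their length bound.  The theorem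
-- applies this to [n] listed in the order of φ₀, which the whole family
-- covers and which is monotone in φ₀.

open import Defs
open import Data.Nat using (ℕ; _≤_; _^_; _∸_)
open import Data.Fin using (Fin)

open import Data.Nat using (suc; _<_; _*_; _+_; _⊔_; z≤n; s≤s; _<?_; _≤?_)
open import Data.Nat.Properties
  using (≤-refl; ≤-trans; <-trans; <-irrefl; <-cmp; ≰⇒>; ⊔-sel; m≤m⊔n; m≤n⊔m; +-identityʳ; ^-distribˡ-+-*)
open import Data.Fin as Fin using (toℕ; fromℕ<; combine)
open import Data.Fin.Properties using (pigeonhole; toℕ-fromℕ<; toℕ-injective; combine-injective)
open import Data.Fin.Permutation using (_⟨$⟩ʳ_; _⟨$⟩ˡ_; inverseˡ; inverseʳ)
open import Data.List using (List; []; _∷_; length; lookup; map; allFin)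
open import Data.List.Properties using (length-map; length-tabulate)
open import Data.List.Membership.Propositional.Properties using (∈-lookup)
open import Data.List.Relation.Unary.All as All using (All; []; _∷_)
open import Data.List.Relation.Unary.AllPairs as AllPairs using (AllPairs; []; _∷_)
import Data.List.Relation.Unary.AllPairs.Properties as AllPairsₚ
open import Data.List.Relation.Unary.Unique.Propositional using (Unique)
open import Data.List.Relation.Binary.Sublist.Propositional using (_⊆_; []; _∷_; _∷ʳ_; ⊆-trans; minimum)
open import Data.List.Relation.Binary.Sublist.Propositional.Properties using (All-resp-⊆)
open import Data.Product using (∃; _×_; _,_; proj₁)
open import Data.Product.Properties using (,-injectiveˡ; ,-injectiveʳ)
open import Data.Sum using (inj₁; inj₂)
open import Function using (_∘_; _on_)
open import Relation.Nullary using (¬_; yes; no; contradiction)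
open import Relation.Binary using (Decidable; Transitive; tri<; tri≈; tri>)
open import Relation.Binary.PropositionalEquality
  using (_≡_; _≢_; refl; sym; trans; cong; cong₂; subst; subst₂; module ≡-Reasoning)

AllPairs-resp-⊆ : ∀ {A : Set} {R : A → A → Set} {xs ys : List A} →
  xs ⊆ ys → AllPairs R ys → AllPairs R xs
AllPairs-resp-⊆ []         []           = []
AllPairs-resp-⊆ (y ∷ʳ xs⊆) (_ ∷ Rys)    = AllPairs-resp-⊆ xs⊆ Rys
AllPairs-resp-⊆ (refl ∷ xs⊆) (Ry ∷ Rys) = All-resp-⊆ xs⊆ Ry ∷ AllPairs-resp-⊆ xs⊆ Rys

AllPairs-lookup : ∀ {A : Set} {R : A → A → Set} {xs : List A} → AllPairs R xs →
  ∀ {i j : Fin (length xs)} → i Fin.< j → R (lookup xs i) (lookup xs j)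
AllPairs-lookup (Rx ∷ _)   {Fin.zero}  {Fin.suc j} _         = All.lookup Rx (∈-lookup j)
AllPairs-lookup (_ ∷ Rxs)  {Fin.suc i} {Fin.suc j} (s≤s i<j) = AllPairs-lookup Rxs i<j

Unique-length : ∀ {m} {xs : List (Fin m)} → Unique xs → length xs ≤ m
Unique-length {m} {xs} unique with length xs ≤? m
... | yes fits = fits
... | no  long with pigeonhole (≰⇒> long) (lookup xs)
...   | i , j , i<j , same = contradiction same (AllPairs-lookup unique i<j)

module _ {A : Set} {P : A → Set} {m : ℕ} (code : ∀ {x} → P x → Fin m)
  (code-injective : ∀ {x y} (px : P x) (py : P y) → code px ≡ code py → x ≡ y) where

  private
    codes : ∀ {xs} → All P xs → List (Fin m)
    codes []         = []
    codes (px ∷ pxs) = code px ∷ codes pxs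

    codes-length : ∀ {xs} (pxs : All P xs) → length (codes pxs) ≡ length xs
    codes-length []         = refl
    codes-length (_ ∷ pxs) = cong suc (codes-length pxs)

    codes-avoid : ∀ {x xs} (px : P x) (pxs : All P xs) → All (x ≢_) xs →
      All (code px ≢_) (codes pxs)
    codes-avoid px []         []           = []
    codes-avoid px (py ∷ pxs) (x≢y ∷ x≢ys) =
      (x≢y ∘ code-injective px py) ∷ codes-avoid px pxs x≢ys

    codes-unique : ∀ {xs} (pxs : All P xs) → Unique xs → Unique (codes pxs)
    codes-unique []         []             = []
    codes-unique (px ∷ pxs) (x≢xs ∷ unique) = codes-avoid px pxs x≢xs ∷ codes-unique pxs unique

  injective-count : ∀ {xs} → All P xs → Unique xs → length xs ≤ m
  injective-count pxs unique =
    subst (_≤ m) (codes-length pxs) (Unique-length (codes-unique pxs unique))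

InBox : ℕ → ℕ → ℕ × ℕ → Set
InBox a b (i , j) = i < a × j < b

box-count : ∀ {a b} {ps : List (ℕ × ℕ)} → All (InBox a b) ps → Unique ps → length ps ≤ a * b
box-count {a} {b} = injective-count code code-injective
  where
  code : ∀ {p} → InBox a b p → Fin (a * b)
  code (i<a , j<b) = combine (fromℕ< i<a) (fromℕ< j<b)

  code-injective : ∀ {p q} (bp : InBox a b p) (bq : InBox a b q) → code bp ≡ code bq → p ≡ q
  code-injective (i<a , j<b) (k<a , l<b) same with combine-injective _ _ _ _ same
  ... | i≡k , j≡l = cong₂ _,_ (coordinate i<a k<a i≡k) (coordinate j<b l<b j≡l)
    where
    coordinate : ∀ {c x y} (x<c : x < c) (y<c : y < c) → fromℕ< x<c ≡ fromℕ< y<c → x ≡ y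
    coordinate x<c y<c eq = trans (sym (toℕ-fromℕ< x<c)) (trans (cong toℕ eq) (toℕ-fromℕ< y<c))

withTail : ∀ {A : Set} → List A → List (A × List A)
withTail []       = []
withTail (x ∷ xs) = (x , xs) ∷ withTail xs

All-withTail : ∀ {A : Set} {P : A → Set} {xs : List A} → All P xs → All (P ∘ proj₁) (withTail xs)
All-withTail []         = []
All-withTail (px ∷ pxs) = px ∷ All-withTail pxs

withTail-length : ∀ {A : Set} (xs : List A) → length (withTail xs) ≡ length xs
withTail-length []       = refl
withTail-length (_ ∷ xs) = cong suc (withTail-length xs)

-- For a decidable transitive relation R, height x ys is the length of a
-- longest R-chain in ys lying R-above x; an R-chain is a list whose pairs
-- are all R-related (in list order).
module Height {A : Set} (R : A → A → Set) (R? : Decidable R) (R-trans : Transitive R) where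

  height : A → List A → ℕ
  height x []       = 0
  height x (y ∷ ys) with R? x y
  ... | yes _ = height x ys ⊔ suc (height y ys)
  ... | no  _ = height x ys

  height-attained : ∀ x ys → ∃ λ zs → zs ⊆ ys × AllPairs R (x ∷ zs) × length zs ≡ height x ys
  height-attained x [] = [] , [] , [] ∷ [] , refl
  height-attained x (y ∷ ys) with R? x y
  ... | no _ with height-attained x ys
  ...   | zs , zs⊆ , chain , size = zs , y ∷ʳ zs⊆ , chain , size
  height-attained x (y ∷ ys) | yes Rxy with ⊔-sel (height x ys) (suc (height y ys))
  ... | inj₁ skip-y with height-attained x ys
  ...   | zs , zs⊆ , chain , size = zs , y ∷ʳ zs⊆ , chain , trans size (sym skip-y)
  height-attained x (y ∷ ys) | yes Rxy | inj₂ take-y with height-attained y ys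
  ...   | zs , zs⊆ , Ryzs ∷ chain , size =
    y ∷ zs , refl ∷ zs⊆ , (Rxy ∷ All.map (R-trans Rxy) Ryzs) ∷ Ryzs ∷ chain ,
    trans (cong suc size) (sym take-y)

  height-below : ∀ {a} x ys → (∀ {zs} → zs ⊆ x ∷ ys → AllPairs R zs → length zs ≤ a) →
    height x ys < a
  height-below x ys bounded with height-attained x ys
  ... | zs , zs⊆ , chain , size = subst (λ h → suc h ≤ _) size (bounded (refl ∷ zs⊆) chain)

  height-mono : ∀ x y ys → height x ys ≤ height x (y ∷ ys)
  height-mono x y ys with R? x y
  ... | yes _ = m≤m⊔n _ _
  ... | no  _ = ≤-refl

  -- An element above x contributes its own chain, extended by x.
  height-step : ∀ x y ys → R x y → height y ys < height x (y ∷ ys)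
  height-step x y ys Rxy with R? x y
  ... | yes _   = m≤n⊔m _ _
  ... | no ¬Rxy = contradiction Rxy ¬Rxy

  height-above : ∀ x ys → All (λ (w , ws) → R x w → height w ws < height x ys) (withTail ys)
  height-above x []       = []
  height-above x (y ∷ ys) =
    height-step x y ys ∷ All.map (λ below Rxw → ≤-trans (below Rxw) (height-mono x y ys)) (height-above x ys)

module ErdősSzekeres {A : Set} (f : A → ℕ) where

  Increasing Decreasing : List A → Set
  Increasing = AllPairs (_<_ on f)
  Decreasing = AllPairs (λ x y → f y < f x)

  Increasing-unique : ∀ {xs} → Increasing xs → Unique xs
  Increasing-unique = AllPairs.map (λ fx<fy x≡y → <-irrefl (cong f x≡y) fx<fy)

  private
    module Up   = Height (_<_ on f) (λ x y → f x <? f y) <-trans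
    module Down = Height (λ x y → f y < f x) (λ x y → f y <? f x) (λ p q → <-trans q p)

  label : A × List A → ℕ × ℕ
  label (x , ys) = Up.height x ys , Down.height x ys

  -- Elements with distinct values get distinct labels: the later one has a
  -- smaller increasing height if it is larger, a smaller decreasing height
  -- if it is smaller.
  label-separates : ∀ {x ys w ws} → f x ≢ f w →
    (f x < f w → Up.height w ws < Up.height x ys) →
    (f w < f x → Down.height w ws < Down.height x ys) →
    label (x , ys) ≢ label (w , ws)
  label-separates {x} {w = w} fx≢fw up down same with <-cmp (f x) (f w)
  ... | tri< fx<fw _ _ = <-irrefl (sym (,-injectiveˡ same)) (up fx<fw)
  ... | tri≈ _ fx≡fw _ = fx≢fw fx≡fw
  ... | tri> _ _ fw<fx = <-irrefl (sym (,-injectiveʳ same)) (down fw<fx)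

  labels-unique : ∀ xs → AllPairs (λ x y → f x ≢ f y) xs → Unique (map label (withTail xs))
  labels-unique xs distinct = AllPairsₚ.map⁺ (separated xs distinct)
    where
    separated : ∀ xs → AllPairs (λ x y → f x ≢ f y) xs →
      AllPairs (λ p q → label p ≢ label q) (withTail xs)
    separated []       []               = []
    separated (x ∷ ys) (fx≢fys ∷ rest) =
      All.zipWith (λ {(w , ws)} (fx≢fw , up , down) → label-separates {x} {ys} {w} {ws} fx≢fw up down)
        (All-withTail fx≢fys , All.zip (Up.height-above x ys , Down.height-above x ys))
      ∷ separated ys rest

  labels-in-box : ∀ {a b} xs →
    (∀ {ys} → ys ⊆ xs → Increasing ys → length ys ≤ a) →
    (∀ {ys} → ys ⊆ xs → Decreasing ys → length ys ≤ b) →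
    All (InBox a b) (map label (withTail xs))
  labels-in-box []       _  _  = []
  labels-in-box (x ∷ ys) up down =
    (Up.height-below x ys up , Down.height-below x ys down)
    ∷ labels-in-box ys (up ∘ (x ∷ʳ_)) (down ∘ (x ∷ʳ_))

  -- The labels are distinct points of the box, so there are at most a * b.
  erdős-szekeres : ∀ a b xs → AllPairs (λ x y → f x ≢ f y) xs →
    (∀ {ys} → ys ⊆ xs → Increasing ys → length ys ≤ a) →
    (∀ {ys} → ys ⊆ xs → Decreasing ys → length ys ≤ b) →
    length xs ≤ a * b
  erdős-szekeres a b xs distinct up down =
    subst (_≤ a * b) labels-length (box-count (labels-in-box xs up down) (labels-unique xs distinct))
    where
    labels-length : length (map label (withTail xs)) ≡ length xs
    labels-length = trans (length-map label (withTail xs)) (withTail-length xs)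

pos : ∀ {n} → Ordering n → Fin n → ℕ
pos φ x = toℕ (φ ⟨$⟩ʳ x)

pos-injective : ∀ {n} (φ : Ordering n) {x y} → x ≢ y → pos φ x ≢ pos φ y
pos-injective φ {x} {y} x≢y same = x≢y (begin
  x                    ≡⟨ sym (inverseˡ φ) ⟩
  φ ⟨$⟩ˡ (φ ⟨$⟩ʳ x)    ≡⟨ cong (φ ⟨$⟩ˡ_) (toℕ-injective same) ⟩
  φ ⟨$⟩ˡ (φ ⟨$⟩ʳ y)    ≡⟨ inverseˡ φ ⟩
  y                    ∎)
  where open ≡-Reasoning

data Monotone {n} (φ : Ordering n) (xs : List (Fin n)) : Set where
  increasing : ErdősSzekeres.Increasing (pos φ) xs → Monotone φ xs
  decreasing : ErdősSzekeres.Decreasing (pos φ) xs → Monotone φ xs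

Monotone-resp-⊆ : ∀ {n} {φ : Ordering n} {xs ys} → xs ⊆ ys → Monotone φ ys → Monotone φ xs
Monotone-resp-⊆ xs⊆ (increasing up)   = increasing (AllPairs-resp-⊆ xs⊆ up)
Monotone-resp-⊆ xs⊆ (decreasing down) = decreasing (AllPairs-resp-⊆ xs⊆ down)

monotone-between : ∀ {n} {φ : Ordering n} {x y z} → Monotone φ (x ∷ y ∷ z ∷ []) → Between φ x y z
monotone-between (increasing ((x<y ∷ _) ∷ (y<z ∷ []) ∷ [] ∷ [])) = inj₁ (x<y , y<z)
monotone-between (decreasing ((y<x ∷ _) ∷ (z<y ∷ []) ∷ [] ∷ [])) = inj₂ (z<y , y<x)

Covers : ∀ {n k} → (Fin k → Ordering n) → List (Fin n) → Set
Covers fam xs = ∀ {x y z} → x ∷ y ∷ z ∷ [] ⊆ xs → ∃ λ i → NonbetSat (fam i) x y z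

family-covers : ∀ {n k} (fam : Fin k → Ordering n) {xs} → NbetFamily n k fam → Unique xs → Covers fam xs
family-covers _ nbet unique triple with AllPairs-resp-⊆ triple unique
... | (x≢y ∷ x≢z ∷ []) ∷ (y≢z ∷ []) ∷ [] ∷ [] = nbet _ _ _ x≢y y≢z x≢z

Covers-resp-⊆ : ∀ {n k} (fam : Fin k → Ordering n) {xs ys} → xs ⊆ ys → Covers fam ys → Covers fam xs
Covers-resp-⊆ _ xs⊆ cover triple = cover (⊆-trans triple xs⊆)

empty-family-covers : ∀ {n} (fam : Fin 0 → Ordering n) {xs} → Covers fam xs → length xs ≤ 2
empty-family-covers _ {[]}                _     = z≤n
empty-family-covers _ {_ ∷ []}            _     = s≤s z≤n
empty-family-covers _ {_ ∷ _ ∷ []}        _     = s≤s (s≤s z≤n)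
empty-family-covers _ {_ ∷ _ ∷ _ ∷ rest} cover with cover (refl ∷ refl ∷ refl ∷ minimum rest)
... | () , _

-- On a list monotone in the first ordering, that ordering satisfies no
-- triple, so the remaining orderings cover the list.
covers-without-first : ∀ {n k} (fam : Fin (suc k) → Ordering n) {xs} →
  Monotone (fam Fin.zero) xs → Covers fam xs → Covers (fam ∘ Fin.suc) xs
covers-without-first _ mono cover triple with cover triple
... | Fin.zero  , nonbetween = contradiction (monotone-between (Monotone-resp-⊆ triple mono)) nonbetween
... | Fin.suc i , nonbetween = i , nonbetween

tower-square : ∀ k → 2 ^ (2 ^ k) * 2 ^ (2 ^ k) ≡ 2 ^ (2 ^ suc k)
tower-square k = begin
  2 ^ (2 ^ k) * 2 ^ (2 ^ k)    ≡⟨ sym (^-distribˡ-+-* 2 (2 ^ k) (2 ^ k)) ⟩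
  2 ^ (2 ^ k + 2 ^ k)          ≡⟨ cong (λ e → 2 ^ (2 ^ k + e)) (sym (+-identityʳ (2 ^ k))) ⟩
  2 ^ (2 ^ suc k)              ∎
  where open ≡-Reasoning

-- Induction on k: sublists monotone in the first ordering are covered by
-- the other k - 1, and Erdős–Szekeres squares their bound.
covered-length : ∀ {n} k (fam : Fin k → Ordering n) xs → Unique xs → Covers fam xs →
  length xs ≤ 2 ^ (2 ^ k)
covered-length 0       fam xs _      cover = empty-family-covers fam cover
covered-length {n} (suc k) fam xs unique cover =
  subst (length xs ≤_) (tower-square k)
    (erdős-szekeres a a xs (AllPairs.map (pos-injective φ₀) unique)
      (λ ys⊆ → monotone-short ys⊆ ∘ increasing) (λ ys⊆ → monotone-short ys⊆ ∘ decreasing))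
  where
  φ₀ : Ordering n
  φ₀ = fam Fin.zero
  open ErdősSzekeres (pos φ₀) using (erdős-szekeres)
  a : ℕ
  a = 2 ^ (2 ^ k)
  monotone-short : ∀ {ys} → ys ⊆ xs → Monotone φ₀ ys → length ys ≤ a
  monotone-short ys⊆ mono = covered-length k (fam ∘ Fin.suc) _ (AllPairs-resp-⊆ ys⊆ unique)
    (covers-without-first fam mono (Covers-resp-⊆ fam ys⊆ cover))

listedBy : ∀ {n} → Ordering n → List (Fin n)
listedBy {n} φ = map (φ ⟨$⟩ˡ_) (allFin n)

listedBy-length : ∀ {n} (φ : Ordering n) → length (listedBy φ) ≡ n
listedBy-length {n} φ = trans (length-map (φ ⟨$⟩ˡ_) (allFin n)) (length-tabulate (λ i → i))

listedBy-increasing : ∀ {n} (φ : Ordering n) → ErdősSzekeres.Increasing (pos φ) (listedBy φ)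
listedBy-increasing φ = AllPairsₚ.map⁺ (AllPairsₚ.tabulate⁺-< (subst₂ _<_ position position))
  where
  position : ∀ {i} → toℕ i ≡ pos φ (φ ⟨$⟩ˡ i)
  position = sym (cong toℕ (inverseʳ φ))

empty-family-fails : ∀ {n} (fam : Fin 0 → Ordering n) → 3 ≤ n → ¬ NbetFamily n 0 fam
empty-family-fails fam (s≤s (s≤s (s≤s _))) nbet
  with nbet Fin.zero (Fin.suc Fin.zero) (Fin.suc (Fin.suc Fin.zero)) (λ ()) (λ ()) (λ ())
... | () , _

lemma2p5 : (n : ℕ) → 3 ≤ n → (k : ℕ) → (fam : Fin k → Ordering n) →
    NbetFamily n k fam → n ≤ 2 ^ (2 ^ (k ∸ 1))
lemma2p5 n 3≤n 0       fam nbet = contradiction nbet (empty-family-fails fam 3≤n)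
lemma2p5 n _   (suc k) fam nbet =
  subst (_≤ 2 ^ (2 ^ k)) (listedBy-length φ₀)
    (covered-length k (fam ∘ Fin.suc) (listedBy φ₀) unique
      (covers-without-first fam (increasing ordered) (family-covers fam nbet unique)))
  where
  φ₀ : Ordering n
  φ₀ = fam Fin.zero
  ordered : ErdősSzekeres.Increasing (pos φ₀) (listedBy φ₀)
  ordered = listedBy-increasing φ₀
  unique : Unique (listedBy φ₀)
  unique = ErdősSzekeres.Increasing-unique (pos φ₀) ordered
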